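{- Let $S$ be the pure $2$-dimensional simplicial complex on vertex set $\{1,\dots,6\}$ with facets $[1,3,5], [2,3,4], [1,2,4], [1,3,6], [1,2,5], [2,3,5], [1,4,5], [1,2,3], [1,2,6], [1,3,4]$. Then $S$ is self-complementary (its complement is isomorphic to $S$ via the vertex map $1\mapsto 6$, $2\mapsto 5$, $3\mapsto 4$, $4\mapsto 2$, $5\mapsto 3$, $6\mapsto 1$), and $S$ admits no weakly-Hamiltonian path (hence no tight- or loose-Hamiltonian path).
   Context: A pure $d$-dimensional complex $S$ on $n$ vertices is self-complementary if it is combinatorially equivalent (isomorphic via a vertex bijection) to its complement, the pure $d$-complex on the same vertex set whose facets are exactly the $(d+1)$-element subsets of the vertex set that are not facets of $S$. For a pure $d$-complex $\Delta$ on $n$ vertices and a labeling of its vertices by $1,\dots,n$, let $H_i$ be the $d$-face with vertices $i,i+1,\dots,i+d$ (sums modulo $n$). A weakly-Hamiltonian path in $\Delta$ is a labeling of the vertices by $1,\dots,n$ together with indices $1 = i_1 < i_2 < \dots < i_k = n-d$ such that every $H_{i_j}$ is a facet of $\Delta$ and $i_{j+1} - i_j \le d$ for all $j$. Tight- and loose-Hamiltonian paths are special cases of weakly-Hamiltonian paths. -}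

module Defs where

open import Data.Nat using (ℕ; zero; suc; _+_; _∸_; _<_; _≤_; NonZero)
open import Data.Nat.DivMod using (_mod_)
open import Data.Fin using (Fin; #_)
open import Data.Fin.Subset using (Subset; ⁅_⁆; _∪_; ∣_∣)
open import Data.Vec using (tabulate; lookup)
open import Data.List using (List; []; _∷_; head; last)
open import Data.List.Membership.Propositional using (_∈_)
open import Data.List.Relation.Unary.All using (All)
open import Data.List.Relation.Unary.Linked using (Linked)
open import Data.Maybe using (just)
open import Data.Product using (Σ; _×_)
open import Relation.Binary.PropositionalEquality using (_≡_; refl)
open import Relation.Nullary using (¬_)
open import Function.Bundles using (_↔_; _⇔_; Inverse; mk↔ₛ′)

-- A pure d-complex on vertex set Fin n is given by its set of facets,
-- a predicate on subsets of the vertex set (each facet has d+1 elements).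
Complex : ℕ → Set₁
Complex n = Subset n → Set

IsPure : ∀ {n} → ℕ → Complex n → Set
IsPure d K = ∀ F → K F → ∣ F ∣ ≡ suc d

Complement : ∀ {n} → ℕ → Complex n → Complex n
Complement d K F = (∣ F ∣ ≡ suc d) × ¬ K F

image : ∀ {n} → Fin n ↔ Fin n → Subset n → Subset n
image σ F = tabulate (λ j → lookup F (Inverse.from σ j))

IsIsoVia : ∀ {n} → Fin n ↔ Fin n → Complex n → Complex n → Set
IsIsoVia σ K L = ∀ F → K F ⇔ L (image σ F)

SelfComplementary : ∀ {n} → ℕ → Complex n → Set
SelfComplementary {n} d K = Σ (Fin n ↔ Fin n) (λ σ → IsIsoVia σ K (Complement d K))

-- Labeling: `label` maps a vertex to its label; label value k : Fin n
-- stands for the label k+1 ∈ {1,…,n}.  The vertex carrying label m ∈ ℕ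
-- (read modulo n, labels 1..n) is:
vertexWithLabel : ∀ {n} .{{_ : NonZero n}} → Fin n ↔ Fin n → ℕ → Fin n
vertexWithLabel {n} label m = Inverse.from label ((m ∸ 1) mod n)

Hface' : ∀ {n} .{{_ : NonZero n}} → Fin n ↔ Fin n → ℕ → ℕ → Subset n
Hface' label i zero    = ⁅ vertexWithLabel label i ⁆
Hface' label i (suc t) = ⁅ vertexWithLabel label (i + suc t) ⁆ ∪ Hface' label i t

Hface : ∀ {n} .{{_ : NonZero n}} → ℕ → Fin n ↔ Fin n → ℕ → Subset n
Hface d label i = Hface' label i d

Step : ℕ → ℕ → ℕ → Set
Step d i j = (i < j) × (j ≤ i + d)

record WeaklyHamiltonianPath {n} .{{_ : NonZero n}} (d : ℕ) (K : Complex n) : Set where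
  field
    label    : Fin n ↔ Fin n
    indices  : List ℕ
    first    : head indices ≡ just 1
    final    : last indices ≡ just (n ∸ d)
    chain    : Linked (Step d) indices
    facets   : All (λ i → K (Hface d label i)) indices

-- Vertex k ∈ {1,…,6} is encoded as # (k-1) : Fin 6.
tri : Fin 6 → Fin 6 → Fin 6 → Subset 6
tri a b c = ⁅ a ⁆ ∪ (⁅ b ⁆ ∪ ⁅ c ⁆)

SFacets : List (Subset 6)
SFacets =
  tri (# 0) (# 2) (# 4) ∷
  tri (# 1) (# 2) (# 3) ∷
  tri (# 0) (# 1) (# 3) ∷
  tri (# 0) (# 2) (# 5) ∷
  tri (# 0) (# 1) (# 4) ∷
  tri (# 1) (# 2) (# 4) ∷
  tri (# 0) (# 3) (# 4) ∷
  tri (# 0) (# 1) (# 2) ∷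
  tri (# 0) (# 1) (# 5) ∷
  tri (# 0) (# 2) (# 3) ∷
  []

S : Complex 6
S F = F ∈ SFacets

σ₀-to : Fin 6 → Fin 6
σ₀-to Fin.zero = # 5
σ₀-to (Fin.suc Fin.zero) = # 4
σ₀-to (Fin.suc (Fin.suc Fin.zero)) = # 3
σ₀-to (Fin.suc (Fin.suc (Fin.suc Fin.zero))) = # 1
σ₀-to (Fin.suc (Fin.suc (Fin.suc (Fin.suc Fin.zero)))) = # 2
σ₀-to (Fin.suc (Fin.suc (Fin.suc (Fin.suc (Fin.suc Fin.zero))))) = # 0

σ₀-from : Fin 6 → Fin 6
σ₀-from Fin.zero = # 5
σ₀-from (Fin.suc Fin.zero) = # 3
σ₀-from (Fin.suc (Fin.suc Fin.zero)) = # 4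
σ₀-from (Fin.suc (Fin.suc (Fin.suc Fin.zero))) = # 2
σ₀-from (Fin.suc (Fin.suc (Fin.suc (Fin.suc Fin.zero)))) = # 1
σ₀-from (Fin.suc (Fin.suc (Fin.suc (Fin.suc (Fin.suc Fin.zero))))) = # 0

σ₀-ft : ∀ x → σ₀-to (σ₀-from x) ≡ x
σ₀-ft Fin.zero = refl
σ₀-ft (Fin.suc Fin.zero) = refl
σ₀-ft (Fin.suc (Fin.suc Fin.zero)) = refl
σ₀-ft (Fin.suc (Fin.suc (Fin.suc Fin.zero))) = refl
σ₀-ft (Fin.suc (Fin.suc (Fin.suc (Fin.suc Fin.zero)))) = refl
σ₀-ft (Fin.suc (Fin.suc (Fin.suc (Fin.suc (Fin.suc Fin.zero))))) = refl

σ₀-tf : ∀ x → σ₀-from (σ₀-to x) ≡ x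
σ₀-tf Fin.zero = refl
σ₀-tf (Fin.suc Fin.zero) = refl
σ₀-tf (Fin.suc (Fin.suc Fin.zero)) = refl
σ₀-tf (Fin.suc (Fin.suc (Fin.suc Fin.zero))) = refl
σ₀-tf (Fin.suc (Fin.suc (Fin.suc (Fin.suc Fin.zero)))) = refl
σ₀-tf (Fin.suc (Fin.suc (Fin.suc (Fin.suc (Fin.suc Fin.zero))))) = refl

σ₀ : Fin 6 ↔ Fin 6
σ₀ = mk↔ₛ′ σ₀-to σ₀-from σ₀-ft σ₀-tf

{-# OPTIONS --safe #-}
-- A weakly-Hamiltonian path starts at index 1 and ends at index n − d, so H₁ (labels 1,…,d+1)
-- and H_{n−d} (labels n−d,…,n) are both facets; when 2(d+1) ≤ n these two faces are disjoint.
-- Any two facets of S share a vertex, so S has no such path.  Purity and self-complementarity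
-- under σ₀ are finite checks over the 64 vertex subsets.
module Submission where

open import Defs
open import Data.Product using (_×_)
open import Relation.Nullary using (¬_)
open import Data.Nat.Base using (nonZero)

open import Level using (Level)
open import Data.Nat using (ℕ; zero; suc; _+_; _∸_; _<_; _≤_; z≤n; s≤s; NonZero; _≟_)
open import Data.Nat.Properties
  using (≤-refl; ≤-trans; ≤-<-trans; n≤1+n; +-identityʳ; +-monoʳ-≤; ∸-monoˡ-≤;
         m∸n+n≡m; ∸-+-assoc; m+n≤o⇒m≤o∸n; m+n≤o⇒m≤o; m≤m+n; +-comm; <⇒≤; <-trans; <⇒≢; ∸-monoʳ-<;
         module ≤-Reasoning)
open import Data.Nat.DivMod using (_mod_; _%_; m<n⇒m%n≡m)
open import Data.Fin using (Fin; toℕ)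
open import Data.Fin.Properties using (toℕ-fromℕ<)
open import Data.Fin.Subset using (Subset; Nonempty; _∩_; ∣_∣) renaming (_∈_ to _∈ₛ_)
open import Data.Fin.Subset.Properties
  using (x∈p∪q⁻; x∈⁅y⁆⇒x≡y; x∈p∩q⁻; nonempty?; anySubset?)
import Data.Bool as Bool
open import Data.Vec.Properties using (≡-dec)
open import Data.List using (List; _∷_; head; last)
open import Data.List.Membership.DecPropositional (≡-dec {n = 6} Bool._≟_) using (_∈?_)
open import Data.List.Relation.Unary.All as All using (All; _∷_; all?)
open import Data.List.Relation.Unary.All.Properties using (last⁺)
open import Data.Maybe using (just)
open import Data.Maybe.Relation.Unary.All as Maybe using ()
open import Data.Product using (_,_; ∃-syntax)
import Data.Product as Product
open import Data.Sum using (inj₁; inj₂)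
open import Function using (_∘_)
open import Function.Bundles using (_↔_; _⇔_; Inverse; Equivalence; mk⇔)
open import Relation.Binary.PropositionalEquality using (_≡_; refl; sym; trans; cong; subst; module ≡-Reasoning)
open import Relation.Nullary using (Dec; ¬?)
open import Relation.Nullary.Decidable using (toWitness; _×-dec_; _→-dec_; map′; decidable-stable)
open import Relation.Unary using (Pred; Decidable)

private
  variable
    ℓ : Level
    n : ℕ

∀-Subset? : {P : Pred (Subset n) ℓ} → Decidable P → Dec (∀ F → P F)
∀-Subset? P? = map′ (λ ¬∃¬P F → decidable-stable (P? F) (¬∃¬P ∘ (F ,_)))
                    (λ ∀P (F , ¬PF) → ¬PF (∀P F))
                    (¬? (anySubset? (¬? ∘ P?)))

_⇔-dec_ : ∀ {a b} {A : Set a} {B : Set b} → Dec A → Dec B → Dec (A ⇔ B)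
A? ⇔-dec B? = map′ (λ (f , g) → mk⇔ f g) (λ A⇔B → Equivalence.to A⇔B , Equivalence.from A⇔B)
                   ((A? →-dec B?) ×-dec (B? →-dec A?))

labelOf-vertexWithLabel : .{{_ : NonZero n}} (L : Fin n ↔ Fin n) {m : ℕ} {j : Fin n} →
                          j ≡ vertexWithLabel L m → Inverse.to L j ≡ (m ∸ 1) mod n
labelOf-vertexWithLabel L {m} refl = Inverse.strictlyInverseˡ L ((m ∸ 1) mod _)

∈Hface'⇒label : .{{_ : NonZero n}} (L : Fin n ↔ Fin n) (i t : ℕ) {j : Fin n} →
                j ∈ₛ Hface' L i t → ∃[ k ] k ≤ t × Inverse.to L j ≡ (i + k ∸ 1) mod n
∈Hface'⇒label {n} L i zero j∈H =
  0 , z≤n , trans (labelOf-vertexWithLabel L {i} (x∈⁅y⁆⇒x≡y (vertexWithLabel L i) j∈H))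
                  (cong (λ m → (m ∸ 1) mod n) (sym (+-identityʳ i)))
∈Hface'⇒label L i (suc t) j∈H with x∈p∪q⁻ _ (Hface' L i t) j∈H
... | inj₁ j∈new =
  suc t , ≤-refl , labelOf-vertexWithLabel L {i + suc t} (x∈⁅y⁆⇒x≡y (vertexWithLabel L (i + suc t)) j∈new)
... | inj₂ j∈old = Product.map₂ (Product.map₁ (λ k≤t → ≤-trans k≤t (n≤1+n t)))
                                (∈Hface'⇒label L i t j∈old)

mod-injective-below : .{{_ : NonZero n}} {m m′ : ℕ} → m < n → m′ < n → m mod n ≡ m′ mod n → m ≡ m′
mod-injective-below {n} {m} {m′} m<n m′<n eq = begin
  m              ≡⟨ sym (m<n⇒m%n≡m m<n) ⟩
  m % n          ≡⟨ sym (toℕ-fromℕ< _) ⟩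
  toℕ (m mod n)  ≡⟨ cong toℕ eq ⟩
  toℕ (m′ mod n) ≡⟨ toℕ-fromℕ< _ ⟩
  m′ % n         ≡⟨ m<n⇒m%n≡m m′<n ⟩
  m′             ∎
  where open ≡-Reasoning

lastFace-label-bounds : ∀ {d k} → suc d + suc d ≤ n → k ≤ d → d < n ∸ d + k ∸ 1 × n ∸ d + k ∸ 1 < n
lastFace-label-bounds {n} {d} {k} 2[1+d]≤n k≤d = lower , upper
  where
  open ≤-Reasoning
  d<n : d < n
  d<n = m+n≤o⇒m≤o (suc d) 2[1+d]≤n
  lower : d < n ∸ d + k ∸ 1
  lower = begin-strict
    d               <⟨ m+n≤o⇒m≤o∸n (suc d) (subst (λ e → suc d + e ≤ n) (+-comm 1 d) 2[1+d]≤n) ⟩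
    n ∸ (d + 1)     ≡⟨ sym (∸-+-assoc n d 1) ⟩
    n ∸ d ∸ 1       ≤⟨ ∸-monoˡ-≤ 1 (m≤m+n (n ∸ d) k) ⟩
    n ∸ d + k ∸ 1   ∎
  upper : n ∸ d + k ∸ 1 < n
  upper = begin-strict
    n ∸ d + k ∸ 1   ≤⟨ ∸-monoˡ-≤ 1 (+-monoʳ-≤ (n ∸ d) k≤d) ⟩
    n ∸ d + d ∸ 1   ≡⟨ cong (_∸ 1) (m∸n+n≡m (<⇒≤ d<n)) ⟩
    n ∸ 1           <⟨ ∸-monoʳ-< (s≤s z≤n) (≤-trans (s≤s z≤n) d<n) ⟩
    n               ∎

Hface-first-last-disjoint : .{{_ : NonZero n}} (d : ℕ) (L : Fin n ↔ Fin n) → suc d + suc d ≤ n →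
                            ¬ Nonempty (Hface d L 1 ∩ Hface d L (n ∸ d))
Hface-first-last-disjoint {n} d L 2[1+d]≤n (j , j∈both)
  with x∈p∩q⁻ (Hface d L 1) (Hface d L (n ∸ d)) j∈both
... | j∈first , j∈last
  with ∈Hface'⇒label L 1 d j∈first | ∈Hface'⇒label L (n ∸ d) d j∈last
... | k , k≤d , label≡k | k′ , k′≤d , label≡k′
  with lastFace-label-bounds 2[1+d]≤n k′≤d
... | d<a , a<n =
  <⇒≢ (≤-<-trans k≤d d<a)
      (mod-injective-below (≤-<-trans k≤d (<-trans d<a a<n)) a<n (trans (sym label≡k) label≡k′))

All-head : ∀ {a} {A : Set a} {P : Pred A ℓ} {xs : List A} {x : A} → All P xs → head xs ≡ just x → P x
All-head (px ∷ _) refl = px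

All-last : ∀ {a} {A : Set a} {P : Pred A ℓ} {xs : List A} {x : A} → All P xs → last xs ≡ just x → P x
All-last {P = P} pxs eq with subst (Maybe.All P) eq (last⁺ pxs)
... | Maybe.just px = px

module _ .{{_ : NonZero n}} {d : ℕ} {K : Complex n} (path : WeaklyHamiltonianPath d K) where
  open WeaklyHamiltonianPath path

  weaklyHamiltonian-endFacets : K (Hface d label 1) × K (Hface d label (n ∸ d))
  weaklyHamiltonian-endFacets = All-head facets first , All-last facets final

Intersecting : Complex n → Set
Intersecting K = ∀ {F G} → K F → K G → Nonempty (F ∩ G)

intersecting⇒¬weaklyHamiltonian : .{{_ : NonZero n}} {d : ℕ} {K : Complex n} →
                                  suc d + suc d ≤ n → Intersecting K → ¬ WeaklyHamiltonianPath d K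
intersecting⇒¬weaklyHamiltonian {d = d} 2[1+d]≤n intersecting path =
  Hface-first-last-disjoint d (WeaklyHamiltonianPath.label path) 2[1+d]≤n
    (Product.uncurry intersecting (weaklyHamiltonian-endFacets path))

Complement? : (d : ℕ) {K : Complex n} → Decidable K → Decidable (Complement d K)
Complement? d K? F = (∣ F ∣ ≟ suc d) ×-dec ¬? (K? F)

isIsoVia? : (σ : Fin n ↔ Fin n) {K L : Complex n} → Decidable K → Decidable L → Dec (IsIsoVia σ K L)
isIsoVia? σ K? L? = ∀-Subset? (λ F → K? F ⇔-dec L? (image σ F))

S? : Decidable S
S? F = F ∈? SFacets

S-pure : IsPure 2 S
S-pure F = All.lookup (toWitness {a? = all? (λ F → ∣ F ∣ ≟ 3) SFacets} _)

S-intersecting : Intersecting S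
S-intersecting F∈S G∈S = All.lookup (All.lookup pairwise F∈S) G∈S
  where
  pairwise : All (λ F → All (λ G → Nonempty (F ∩ G)) SFacets) SFacets
  pairwise = toWitness {a? = all? (λ F → all? (λ G → nonempty? (F ∩ G)) SFacets) SFacets} _

σ₀-iso : IsIsoVia σ₀ S (Complement 2 S)
σ₀-iso = toWitness {a? = isIsoVia? σ₀ S? (Complement? 2 S?)} _

mainTheorem3 : IsPure 2 S × SelfComplementary 2 S × IsIsoVia σ₀ S (Complement 2 S) × ¬ WeaklyHamiltonianPath 2 S
mainTheorem3 = S-pure , (σ₀ , σ₀-iso) , σ₀-iso , intersecting⇒¬weaklyHamiltonian ≤-refl S-intersecting
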